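{- Let $G$ be a nontrivial finite abelian group and let $n$ denote its exponent. Then $\mathsf{D}_{\mathbb{Z} \setminus n\mathbb{Z}}(G) = \operatorname{rank}_n(G) + 1$.
   Context: Groups are written additively. For a nontrivial finite abelian group $G \cong C_{n_1}\oplus\dots\oplus C_{n_r}$ with $1 < n_1 \mid \dots \mid n_r$ (where $C_m$ is cyclic of order $m$) and an integer $n$, $\operatorname{rank}_n(G) = |\{ i \colon n \mid n_i\}|$. For a non-empty set of weights $A \subset \mathbb{Z}$, $\mathsf{D}_A(G)$ is the smallest positive integer $\ell$ such that for every sequence $g_1, \dots, g_k$ of elements of $G$ (repetitions allowed) with $k \ge \ell$ there exist a non-empty subset $I \subset \{1,\dots,k\}$ and weights $a_i \in A$ ($i \in I$) with $\sum_{i\in I} a_i g_i = 0$. -}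

module Defs where

open import Data.Nat as ℕ using (ℕ; zero; suc; _≤_; _<_)
open import Data.Nat.Divisibility as ℕD using (_∣?_)
open import Data.Integer as ℤ using (ℤ; +_; 0ℤ)
open import Data.Integer.Divisibility as ℤD using ()
open import Data.Fin as Fin using (Fin; toℕ; fromℕ)
open import Data.Bool using (Bool; true; false; if_then_else_)
open import Data.Product using (Σ; ∃; _×_; _,_)
open import Relation.Nullary using (¬_; does)
open import Relation.Binary.PropositionalEquality using (_≡_)

Σℤ : ∀ {k} → (Fin k → ℤ) → ℤ
Σℤ {zero}  f = 0ℤ
Σℤ {suc k} f = f Fin.zero ℤ.+ Σℤ (λ i → f (Fin.suc i))

countF : ∀ {k} → (Fin k → Bool) → ℕ
countF {zero}  p = 0
countF {suc k} p = (if p Fin.zero then 1 else 0) ℕ.+ countF (λ i → p (Fin.suc i))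

-- Invariant-factor data of a nontrivial finite abelian group
-- G ≅ C_{n_1} ⊕ … ⊕ C_{n_r}, r = suc r' ≥ 1, 1 < n_1 ∣ … ∣ n_r.
record InvariantFactors (r : ℕ) : Set where
  field
    n       : Fin r → ℕ
    n>1     : ∀ i → 1 < n i
    n-chain : ∀ i j → i Fin.≤ j → n i ℕD.∣ n j

Elem : ∀ {r} → InvariantFactors r → Set
Elem {r} F = (j : Fin r) → Fin (InvariantFactors.n F j)

-- Exponent of G (nontrivial, r = suc r'): the largest invariant factor n_r.
exponent : ∀ {r'} → InvariantFactors (suc r') → ℕ
exponent {r'} F = InvariantFactors.n F (fromℕ r')

rank : ∀ {r} → ℕ → InvariantFactors r → ℕ
rank m F = countF (λ i → does (m ∣? InvariantFactors.n F i))

-- Σ_{i ∈ I} a_i g_i = 0 in G, where I ⊆ {1..k} is given by its indicator.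
-- Computed componentwise: the j-th component of the sum is ≡ 0 mod n_j.
WeightedZeroSum : ∀ {r k} (F : InvariantFactors r) →
  (g : Fin k → Elem F) (I : Fin k → Bool) (a : Fin k → ℤ) → Set
WeightedZeroSum F g I a =
  ∀ j → (+ InvariantFactors.n F j) ℤD.∣
        Σℤ (λ i → if I i then a i ℤ.* (+ toℕ (g i j)) else 0ℤ)

DProp : ∀ {r} → (ℤ → Set) → InvariantFactors r → ℕ → Set
DProp A F ℓ =
  ∀ k → ℓ ≤ k → (g : Fin k → Elem F) →
    Σ (Fin k → Bool) λ I → Σ (Fin k → ℤ) λ a →
      (∃ λ i → I i ≡ true) ×
      (∀ i → I i ≡ true → A (a i)) ×
      WeightedZeroSum F g I a

D_A≡ : ∀ {r} → (ℤ → Set) → InvariantFactors r → ℕ → Set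
D_A≡ A F d = (1 ≤ d × DProp A F d) × (∀ ℓ → 1 ≤ ℓ → DProp A F ℓ → d ≤ ℓ)

NotMultipleOf : ℕ → ℤ → Set
NotMultipleOf m a = ¬ ((+ m) ℤD.∣ a)

{-# OPTIONS --safe #-}
-- Let n be the exponent and s = rank_n G the number of cyclic factors of order n.
-- Lower bound: in a weighted zero-sum of the s unit vectors of those factors, every weight used
-- is divisible by n.
-- Upper bound: write n = q p, where q is the largest invariant factor different from n (q = 1 if
-- there is none), so p > 1 and every other factor divides q. Among s + 1 elements g_i, two of the
-- p^(s+1) coefficient vectors c ∈ [0, p)^(s+1) give the same residues mod p of Σ c_i g_i in all s
-- factors of order n. For such a collision c ≠ c', the weights q (c_i - c'_i) are not multiples of
-- n, and the weighted sum vanishes: in the factors of order n since p divides the collision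
-- difference, in the others since their order divides q.
module Submission where

open import Defs
open import Data.Nat using (ℕ; suc)
open import Data.Bool using (Bool; true; false; not; if_then_else_)
open import Data.Empty using (⊥-elim)
open import Data.Fin as Fin using (Fin; zero; suc; toℕ; fromℕ; fromℕ<; funToFin; finToFun)
import Data.Fin.Properties as Finₚ
open import Data.Integer as ℤ using (ℤ; +_; 0ℤ; _%ℕ_; _/ℕ_)
import Data.Integer.Properties as ℤₚ
import Data.Integer.Divisibility as ℤᵤ
import Data.Integer.Divisibility.Signed as ℤₛ
open import Data.Integer.DivMod using (n%ℕd<d; a≡a%ℕn+[a/ℕn]*n)
open import Data.Integer.Tactic.RingSolver using (solve-∀)
open import Data.Nat as ℕ using (zero; NonZero; _<_)
import Data.Nat.Properties as ℕₚ
open import Data.Nat.Divisibility as ℕᵈ using (_∣_; _∣?_)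
open import Data.Product using (Σ; ∃; ∃₂; _×_; _,_)
open import Data.Sum using (_⊎_; inj₁; inj₂)
open import Function using (_∘_)
open import Relation.Nullary using (¬_; Dec; yes; no; does; ¬?)
open import Relation.Nullary.Decidable using (dec-false)
open import Relation.Unary using (Pred; Decidable)
open import Relation.Binary.PropositionalEquality

open InvariantFactors using (n; n>1; n-chain)

Σℤ-cong : ∀ {k} {f g : Fin k → ℤ} → f ≗ g → Σℤ f ≡ Σℤ g
Σℤ-cong {zero}  f≗g = refl
Σℤ-cong {suc k} f≗g = cong₂ ℤ._+_ (f≗g zero) (Σℤ-cong (f≗g ∘ suc))

Σℤ-zero : ∀ {k} (f : Fin k → ℤ) → (∀ i → f i ≡ 0ℤ) → Σℤ f ≡ 0ℤ
Σℤ-zero {zero}  f f≗0 = refl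
Σℤ-zero {suc k} f f≗0 = cong₂ ℤ._+_ (f≗0 zero) (Σℤ-zero (f ∘ suc) (f≗0 ∘ suc))

Σℤ-single : ∀ {k} (f : Fin k → ℤ) t → (∀ i → i ≢ t → f i ≡ 0ℤ) → Σℤ f ≡ f t
Σℤ-single {suc k} f zero    off = begin
  f zero ℤ.+ Σℤ (f ∘ suc) ≡⟨ cong (ℤ._+_ (f zero)) (Σℤ-zero (f ∘ suc) (λ i → off (suc i) λ ())) ⟩
  f zero ℤ.+ 0ℤ           ≡⟨ ℤₚ.+-identityʳ (f zero) ⟩
  f zero                  ∎
  where open ≡-Reasoning
Σℤ-single {suc k} f (suc t) off = begin
  f zero ℤ.+ Σℤ (f ∘ suc) ≡⟨ cong (ℤ._+ Σℤ (f ∘ suc)) (off zero λ ()) ⟩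
  0ℤ ℤ.+ Σℤ (f ∘ suc)     ≡⟨ ℤₚ.+-identityˡ (Σℤ (f ∘ suc)) ⟩
  Σℤ (f ∘ suc)            ≡⟨ Σℤ-single (f ∘ suc) t (λ i i≢t → off (suc i) (i≢t ∘ Finₚ.suc-injective)) ⟩
  f (suc t)               ∎
  where open ≡-Reasoning

Σℤ-scaled-difference : ∀ {k} u (f g : Fin k → ℤ) →
  Σℤ (λ i → u ℤ.* (f i ℤ.- g i)) ≡ u ℤ.* (Σℤ f ℤ.- Σℤ g)
Σℤ-scaled-difference {zero}  u f g = sym (ℤₚ.*-zeroʳ u)
Σℤ-scaled-difference {suc k} u f g =
  trans (cong (ℤ._+_ (u ℤ.* (f zero ℤ.- g zero))) (Σℤ-scaled-difference u (f ∘ suc) (g ∘ suc)))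
        (distrib u (f zero) (g zero) (Σℤ (f ∘ suc)) (Σℤ (g ∘ suc)))
  where
  distrib : ∀ u a b x y → u ℤ.* (a ℤ.- b) ℤ.+ u ℤ.* (x ℤ.- y) ≡ u ℤ.* ((a ℤ.+ x) ℤ.- (b ℤ.+ y))
  distrib = solve-∀

residue : ∀ p .{{_ : NonZero p}} → ℤ → Fin p
residue p x = fromℕ< (n%ℕd<d x p)

residue-≡⇒∣- : ∀ p .{{_ : NonZero p}} x y → residue p x ≡ residue p y → + p ℤₛ.∣ x ℤ.- y
residue-≡⇒∣- p x y eq = ℤₛ.divides (x /ℕ p ℤ.- y /ℕ p) (begin
  x ℤ.- y
    ≡⟨ cong₂ ℤ._-_ (a≡a%ℕn+[a/ℕn]*n x p) (a≡a%ℕn+[a/ℕn]*n y p) ⟩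
  (+ (x %ℕ p) ℤ.+ x /ℕ p ℤ.* + p) ℤ.- (+ (y %ℕ p) ℤ.+ y /ℕ p ℤ.* + p)
    ≡⟨ cong (λ r → (+ r ℤ.+ x /ℕ p ℤ.* + p) ℤ.- (+ (y %ℕ p) ℤ.+ y /ℕ p ℤ.* + p)) x%p≡y%p ⟩
  (+ (y %ℕ p) ℤ.+ x /ℕ p ℤ.* + p) ℤ.- (+ (y %ℕ p) ℤ.+ y /ℕ p ℤ.* + p)
    ≡⟨ cancel (+ (y %ℕ p)) (x /ℕ p) (y /ℕ p) (+ p) ⟩
  (x /ℕ p ℤ.- y /ℕ p) ℤ.* + p ∎)
  where
  open ≡-Reasoning
  x%p≡y%p : x %ℕ p ≡ y %ℕ p
  x%p≡y%p = trans (sym (Finₚ.toℕ-fromℕ< _)) (trans (cong toℕ eq) (Finₚ.toℕ-fromℕ< _))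
  cancel : ∀ r a b m → (r ℤ.+ a ℤ.* m) ℤ.- (r ℤ.+ b ℤ.* m) ≡ (a ℤ.- b) ℤ.* m
  cancel = solve-∀

∤-difference : ∀ {p a b} → a < p → b < p → a ≢ b → ¬ (+ p ℤᵤ.∣ + a ℤ.- + b)
∤-difference {p} {a} {b} a<p b<p a≢b = ℕᵈ.>⇒∤ {{d≢0}} d<p
  where
  d : ℕ
  d = ℤ.∣ + a ℤ.- + b ∣
  d≢0 : NonZero d
  d≢0 = ℕ.≢-nonZero (a≢b ∘ ℤₚ.+-injective ∘ ℤₚ.i-j≡0⇒i≡j (+ a) (+ b) ∘ ℤₚ.∣i∣≡0⇒i≡0)
  d<p : d < p
  d<p = subst (_< p) (cong ℤ.∣_∣ (sym (ℤₚ.[+m]-[+n]≡m⊖n a b)))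
              (ℕₚ.≤-<-trans (ℤₚ.∣m⊝n∣≤m⊔n a b) (ℕₚ.⊔-lub a<p b<p))

does≡true⇒ : ∀ {a} {A : Set a} (A? : Dec A) → does A? ≡ true → A
does≡true⇒ (yes a) _ = a
does≡true⇒ (no _) ()

does≡false⇒¬ : ∀ {a} {A : Set a} (A? : Dec A) → does A? ≡ false → ¬ A
does≡false⇒¬ (no ¬a) _ = ¬a
does≡false⇒¬ (yes _) ()

funToFin-injective : ∀ {m k} {f g : Fin m → Fin k} → funToFin f ≡ funToFin g → f ≗ g
funToFin-injective {f = f} {g} eq i = begin
  f i                      ≡⟨ Finₚ.finToFun-funToFin f i ⟨
  finToFun (funToFin f) i  ≡⟨ cong (λ x → finToFun x i) eq ⟩
  finToFun (funToFin g) i  ≡⟨ Finₚ.finToFun-funToFin g i ⟩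
  g i                      ∎
  where open ≡-Reasoning

funToFin-cong : ∀ {m k} {f g : Fin m → Fin k} → f ≗ g → funToFin f ≡ funToFin g
funToFin-cong {zero}  f≗g = refl
funToFin-cong {suc m} f≗g = cong₂ Fin.combine (f≗g zero) (funToFin-cong (f≗g ∘ suc))

finToFun-injective : ∀ {m k} {x y : Fin (k ℕ.^ m)} → finToFun {k} {m} x ≗ finToFun y → x ≡ y
finToFun-injective {m} {k} {x} {y} x≗y = begin
  x                              ≡⟨ Finₚ.funToFin-finToFin {m} {k} x ⟨
  funToFin (finToFun {k} {m} x)  ≡⟨ funToFin-cong x≗y ⟩
  funToFin (finToFun {k} {m} y)  ≡⟨ Finₚ.funToFin-finToFin {m} {k} y ⟩
  y                              ∎
  where open ≡-Reasoning

pigeonhole-→ : ∀ {p k s} → 1 < p → s < k → (f : (Fin k → Fin p) → (Fin s → Fin p)) →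
  ∃₂ λ c c' → (∃ λ i → c i ≢ c' i) × f c ≗ f c'
pigeonhole-→ {p} {k} 1<p s<k f
  with x , y , x<y , fx≡fy ← Finₚ.pigeonhole (ℕₚ.^-monoʳ-< p 1<p s<k) (funToFin ∘ f ∘ finToFun)
  = finToFun x , finToFun y
  , Finₚ.¬∀⟶∃¬ k _ (λ i → finToFun x i Fin.≟ finToFun y i) (Finₚ.<⇒≢ x<y ∘ finToFun-injective)
  , funToFin-injective fx≡fy

position-cons : ∀ {c r} (b : Bool) → (Fin c → Fin r) → Fin ((if b then 1 else 0) ℕ.+ c) → Fin (suc r)
position-cons true  pos zero    = zero
position-cons true  pos (suc t) = suc (pos t)
position-cons false pos t       = suc (pos t)

position : ∀ {r} (P : Fin r → Bool) → Fin (countF P) → Fin r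
position {suc r} P = position-cons (P zero) (position (P ∘ suc))

position-true : ∀ {r} (P : Fin r → Bool) t → P (position P t) ≡ true
position-true {suc r} P t with P zero in P₀ | t
... | true  | zero   = P₀
... | true  | suc t' = position-true (P ∘ suc) t'
... | false | t'     = position-true (P ∘ suc) t'

position-injective : ∀ {r} (P : Fin r → Bool) {t t'} → position P t ≡ position P t' → t ≡ t'
position-injective {suc r} P {t} {t'} eq with P zero | t | t' | eq
... | true  | zero  | zero  | _   = refl
... | true  | suc u | suc v | eq' = cong suc (position-injective (P ∘ suc) (Finₚ.suc-injective eq'))
... | false | u     | v     | eq' = position-injective (P ∘ suc) (Finₚ.suc-injective eq')

position-surjective : ∀ {r} (P : Fin r → Bool) {j} → P j ≡ true → ∃ λ t → position P t ≡ j
position-surjective {suc r} P {zero}  Pj with P zero | Pj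
... | true | _ = zero , refl
position-surjective {suc r} P {suc j} Pj with P zero | position-surjective (P ∘ suc) Pj
... | true  | t , eq = suc t , cong suc eq
... | false | t , eq = t , cong suc eq

greatest? : ∀ {r p} {P : Pred (Fin r) p} → Decidable P →
  (∀ j → ¬ P j) ⊎ ∃ λ j → P j × ∀ i → P i → i Fin.≤ j
greatest? {zero}  P? = inj₁ λ ()
greatest? {suc r} P? with greatest? (P? ∘ suc) | P? zero
... | inj₂ (j , Pj , max) | _      = inj₂ (suc j , Pj , λ { zero _ → ℕ.z≤n ; (suc i) Pi → ℕ.s≤s (max i Pi) })
... | inj₁ none           | yes P₀ = inj₂ (zero , P₀ , λ { zero _ → ℕ.z≤n ; (suc i) Pi → ⊥-elim (none i Pi) })
... | inj₁ none           | no ¬P₀ = inj₁ λ { zero → ¬P₀ ; (suc i) → none i }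

HasWeightedZeroSum : ∀ {r k} → (ℤ → Set) → (F : InvariantFactors r) → (Fin k → Elem F) → Set
HasWeightedZeroSum {k = k} A F g =
  Σ (Fin k → Bool) λ I → Σ (Fin k → ℤ) λ a →
    (∃ λ i → I i ≡ true) × (∀ i → I i ≡ true → A (a i)) × WeightedZeroSum F g I a

divisibleFactor : ∀ {r} → ℕ → InvariantFactors r → Fin r → Bool
divisibleFactor m F j = does (m ∣? n F j)

n≢0 : ∀ {r} (F : InvariantFactors r) j → NonZero (n F j)
n≢0 F j = ℕ.>-nonZero (ℕₚ.<-trans ℕ.z<s (n>1 F j))

n∣exponent : ∀ {r'} (F : InvariantFactors (suc r')) j → n F j ∣ exponent F
n∣exponent {r'} F j = n-chain F j (fromℕ r') (Finₚ.≤fromℕ j)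

basis : ∀ {r} (F : InvariantFactors r) → Fin r → Elem F
basis F j j' with j' Fin.≟ j
... | yes _ = fromℕ< (n>1 F j')
... | no _  = fromℕ< (ℕ.>-nonZero⁻¹ (n F j') {{n≢0 F j'}})

toℕ-basis-≡ : ∀ {r} (F : InvariantFactors r) j → toℕ (basis F j j) ≡ 1
toℕ-basis-≡ F j with j Fin.≟ j
... | yes _  = Finₚ.toℕ-fromℕ< (n>1 F j)
... | no j≢j = ⊥-elim (j≢j refl)

toℕ-basis-≢ : ∀ {r} (F : InvariantFactors r) {j j'} → j' ≢ j → toℕ (basis F j j') ≡ 0
toℕ-basis-≢ F {j} {j'} j'≢j with j' Fin.≟ j
... | yes j'≡j = ⊥-elim (j'≢j j'≡j)
... | no _     = Finₚ.toℕ-fromℕ< (ℕ.>-nonZero⁻¹ (n F j') {{n≢0 F j'}})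

zeroSum-basis⇒∣ : ∀ {r k} (F : InvariantFactors r) (e : Fin k → Fin r) →
  (∀ {i i'} → e i ≡ e i' → i ≡ i') →
  ∀ I a → WeightedZeroSum F (basis F ∘ e) I a → ∀ i → I i ≡ true → + n F (e i) ℤᵤ.∣ a i
zeroSum-basis⇒∣ F e e-injective I a zs i Ii =
  subst (+ n F (e i) ℤᵤ.∣_) (trans (Σℤ-single term i off) on) (zs (e i))
  where
  term : _ → ℤ
  term i' = if I i' then a i' ℤ.* + toℕ (basis F (e i') (e i)) else 0ℤ
  off : ∀ i' → i' ≢ i → term i' ≡ 0ℤ
  off i' i'≢i with I i'
  ... | true  = trans (cong (λ v → a i' ℤ.* + v) (toℕ-basis-≢ F (i'≢i ∘ sym ∘ e-injective)))
                      (ℤₚ.*-zeroʳ (a i'))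
  ... | false = refl
  on : term i ≡ a i
  on rewrite Ii = trans (cong (λ v → a i ℤ.* + v) (toℕ-basis-≡ F (e i))) (ℤₚ.*-identityʳ (a i))

¬zeroSum-basis-rank : ∀ {r} (F : InvariantFactors r) m →
  ¬ HasWeightedZeroSum (NotMultipleOf m) F (basis F ∘ position (divisibleFactor m F))
¬zeroSum-basis-rank F m (I , a , (i , Ii) , weights , zs) =
  weights i Ii (ℕᵈ.∣-trans m∣n (zeroSum-basis⇒∣ F (position P) (position-injective P) I a zs i Ii))
  where
  P = divisibleFactor m F
  m∣n : m ∣ n F (position P i)
  m∣n = does≡true⇒ (m ∣? _) (position-true P i)

DProp-NotMultipleOf⇒rank< : ∀ {r} (F : InvariantFactors r) m ℓ →
  DProp (NotMultipleOf m) F ℓ → rank m F < ℓ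
DProp-NotMultipleOf⇒rank< F m ℓ D with rank m F ℕₚ.<? ℓ
... | yes s<ℓ = s<ℓ
... | no s≮ℓ  = ⊥-elim (¬zeroSum-basis-rank F m (D (rank m F) (ℕₚ.≮⇒≥ s≮ℓ) _))

combination : ∀ {r k p} (F : InvariantFactors r) → (Fin k → Elem F) → (Fin k → Fin p) → Fin r → ℤ
combination F g c j = Σℤ λ i → + toℕ (c i) ℤ.* + toℕ (g i j)

collision⇒zeroSum : ∀ {r k} (F : InvariantFactors r) (P : Fin r → Bool) q p
  .{{_ : NonZero q}} .{{_ : NonZero p}} →
  (∀ j → n F j ∣ q ℕ.* p) → (∀ j → P j ≡ false → n F j ∣ q) →
  (g : Fin k → Elem F) (c c' : Fin k → Fin p) → (∃ λ i → c i ≢ c' i) →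
  (∀ t → residue p (combination F g c (position P t))
        ≡ residue p (combination F g c' (position P t))) →
  HasWeightedZeroSum (NotMultipleOf (q ℕ.* p)) F g
collision⇒zeroSum F P q p ∣qp ∣q g c c' (i₀ , c≢c') same =
  I , a , (i₀ , cong not (dec-false (c i₀ Fin.≟ c' i₀) c≢c')) , weights , zeroSum
  where
  I : _ → Bool
  I i = not (does (c i Fin.≟ c' i))
  a : _ → ℤ
  a i = + q ℤ.* (+ toℕ (c i) ℤ.- + toℕ (c' i))

  I⇒≢ : ∀ i → I i ≡ true → c i ≢ c' i
  I⇒≢ i Ii with c i Fin.≟ c' i
  ... | no c≢c'ᵢ = c≢c'ᵢ

  weights : ∀ i → I i ≡ true → NotMultipleOf (q ℕ.* p) (a i)
  weights i Ii qp∣a = ∤-difference (Finₚ.toℕ<n (c i)) (Finₚ.toℕ<n (c' i)) (I⇒≢ i Ii ∘ Finₚ.toℕ-injective)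
    (ℤᵤ.*-cancelˡ-∣ (+ q) (subst (ℤᵤ._∣ a i) (ℤₚ.pos-* q p) qp∣a))

  term : ∀ j i → (if I i then a i ℤ.* + toℕ (g i j) else 0ℤ)
               ≡ + q ℤ.* (+ toℕ (c i) ℤ.* + toℕ (g i j) ℤ.- + toℕ (c' i) ℤ.* + toℕ (g i j))
  term j i with c i Fin.≟ c' i
  ... | yes cᵢ≡c'ᵢ rewrite cᵢ≡c'ᵢ = vanish (+ q) (+ toℕ (c' i)) (+ toℕ (g i j))
    where
    vanish : ∀ u x y → 0ℤ ≡ u ℤ.* (x ℤ.* y ℤ.- x ℤ.* y)
    vanish = solve-∀
  ... | no _ = distrib (+ q) (+ toℕ (c i)) (+ toℕ (c' i)) (+ toℕ (g i j))
    where
    distrib : ∀ u x x' y → u ℤ.* (x ℤ.- x') ℤ.* y ≡ u ℤ.* (x ℤ.* y ℤ.- x' ℤ.* y)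
    distrib = solve-∀

  agree : ∀ j → P j ≡ true → + p ℤₛ.∣ combination F g c j ℤ.- combination F g c' j
  agree j Pj with t , refl ← position-surjective P Pj =
    residue-≡⇒∣- p (combination F g c j) (combination F g c' j) (same t)

  divides : ∀ j → + n F j ℤₛ.∣ + q ℤ.* (combination F g c j ℤ.- combination F g c' j)
  divides j with P j in Pj
  ... | true  = ℤₛ.∣-trans (subst (_ ℤₛ.∣_) (ℤₚ.pos-* q p) (ℤₛ.∣ᵤ⇒∣ {+ n F j} {+ (q ℕ.* p)} (∣qp j)))
                           (ℤₛ.*-monoʳ-∣ (+ q) (agree j Pj))
  ... | false = ℤₛ.∣m⇒∣m*n (combination F g c j ℤ.- combination F g c' j)
                           (ℤₛ.∣ᵤ⇒∣ {+ n F j} {+ q} (∣q j Pj))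

  weightedSum : ∀ j → Σℤ (λ i → if I i then a i ℤ.* + toℕ (g i j) else 0ℤ)
                    ≡ + q ℤ.* (combination F g c j ℤ.- combination F g c' j)
  weightedSum j = trans (Σℤ-cong (term j)) (Σℤ-scaled-difference (+ q)
    (λ i → + toℕ (c i) ℤ.* + toℕ (g i j)) (λ i → + toℕ (c' i) ℤ.* + toℕ (g i j)))

  zeroSum : WeightedZeroSum F g I a
  zeroSum j = ℤₛ.∣⇒∣ᵤ (subst (_ ℤₛ.∣_) (sym (weightedSum j)) (divides j))

DProp-NotMultipleOf-product : ∀ {r} (F : InvariantFactors r) (P : Fin r → Bool) q p
  .{{_ : NonZero q}} →
  1 < p → (∀ j → n F j ∣ q ℕ.* p) → (∀ j → P j ≡ false → n F j ∣ q) →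
  DProp (NotMultipleOf (q ℕ.* p)) F (suc (countF P))
DProp-NotMultipleOf-product F P q p 1<p ∣qp ∣q k s<k g =
  let c , c' , c≢c' , same = pigeonhole-→ 1<p s<k residues
  in  collision⇒zeroSum F P q p ∣qp ∣q g c c' c≢c' same
  where
  instance
    p≢0 : NonZero p
    p≢0 = ℕ.>-nonZero (ℕₚ.<-trans ℕ.z<s 1<p)
  residues : (Fin k → Fin p) → Fin (countF P) → Fin p
  residues c t = residue p (combination F g c (position P t))

record ExponentSplitting {r'} (F : InvariantFactors (suc r')) : Set where
  field
    q p          : ℕ
    q≢0          : NonZero q
    1<p          : 1 < p
    q*p≡exponent : q ℕ.* p ≡ exponent F
    n∣q          : ∀ j → ¬ exponent F ∣ n F j → n F j ∣ q

exponentSplitting : ∀ {r'} (F : InvariantFactors (suc r')) → ExponentSplitting F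
exponentSplitting {r'} F with greatest? (λ j → ¬? (exponent F ∣? n F j))
... | inj₁ none = record
  { q = 1 ; p = exponent F ; q≢0 = _ ; 1<p = n>1 F (fromℕ r') ; q*p≡exponent = ℕₚ.*-identityˡ _
  ; n∣q = λ j e∤n → ⊥-elim (none j e∤n) }
... | inj₂ (j₀ , e∤n₀ , greatest) = record
  { q = n F j₀ ; p = ℕᵈ.quotient n₀∣e ; q≢0 = n≢0 F j₀
  ; 1<p = ℕᵈ.quotient>1 n₀∣e n₀<e
  ; q*p≡exponent = sym (ℕᵈ.m∣n⇒n≡m*quotient n₀∣e)
  ; n∣q = λ j e∤n → n-chain F j j₀ (greatest j e∤n) }
  where
  n₀∣e : n F j₀ ∣ exponent F
  n₀∣e = n∣exponent F j₀
  n₀<e : n F j₀ < exponent F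
  n₀<e = ℕₚ.≤∧≢⇒< (ℕᵈ.∣⇒≤ {{n≢0 F (fromℕ r')}} n₀∣e)
                   (λ n₀≡e → e∤n₀ (subst (ℕᵈ._∣ n F j₀) n₀≡e ℕᵈ.∣-refl))

theorem5p2 : ∀ {r'} (F : InvariantFactors (suc r')) →
    D_A≡ (NotMultipleOf (exponent F)) F (suc (rank (exponent F) F))
theorem5p2 F =
  (ℕ.s≤s ℕ.z≤n , subst (λ m → DProp (NotMultipleOf m) F (suc s)) q*p≡exponent upper) ,
  λ ℓ _ → DProp-NotMultipleOf⇒rank< F (exponent F) ℓ
  where
  open ExponentSplitting (exponentSplitting F)
  s = rank (exponent F) F
  upper : DProp (NotMultipleOf (q ℕ.* p)) F (suc s)
  upper = DProp-NotMultipleOf-product F (divisibleFactor (exponent F) F) q p {{q≢0}} 1<p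
    (λ j → subst (n F j ∣_) (sym q*p≡exponent) (n∣exponent F j))
    (λ j e∤n → n∣q j (does≡false⇒¬ (exponent F ∣? n F j) e∤n))
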